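{- Let $R$ be a closed SMLL net, i.e. no occurrence of $\bot$ appears in its conclusions. If $R$ is in normal form for $\to$, then $R$ is cut-free.
   Context: SMLL formulas: $A ::= 1 \mid \bot \mid X \mid X^\bot \mid A\otimes A \mid A ⅋ A$ (⅋ is "par"), involutive negation with $1^\bot=\bot$, $(A\otimes B)^\bot=A^\bot ⅋ B^\bot$. Positive formulas $P ::= 1 \mid P\otimes P$; negative $N ::= \bot \mid N ⅋ N$. SMLL nets are built from axiom, cut, $\otimes$, ⅋, one (conclusion $1$) and bot (conclusion $\bot$) links, each bot link coming with a box of conclusions $\bot,\Gamma$ ($\bot$ its lock) containing a net of conclusions $\Gamma$, and from $n$-ary sync links whose $i$-th premiss and $i$-th conclusion share a positive or negative type (in-edges: positive premisses and negative conclusions; out-edges: positive conclusions and negative premisses). Correctness: the 0-graph (boxes replaced by single nodes, depth 0 only) has no cyclic switching path (undirected simple path using at most one premiss of each ⅋ and at most one out-edge of each sync link), and each box content is correct. Reduction $\to$ takes place only at depth 0 (lazy: no reduction inside boxes, no commutation with boxes): axiom/cut; $\otimes$/⅋ cut replaced by two cuts; pushing a sync link above a $\otimes$ or ⅋ link; moving a sync from the positive conclusion $P$ of an axiom to its other conclusion $P^\bot$; moving a sync from premiss $P^\bot$ of a cut to the other premiss $P$; erasing a sync whose premisses are all conclusions of one links; opening a box whose lock is cut against a one link. -}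

module Defs where

open import Data.Nat using (ℕ; zero; suc; _≤_)
open import Data.Fin using (Fin; toℕ)
open import Data.Fin.Properties using (_≟_)
open import Data.List using (List; []; _∷_; map; concatMap; allFin; filter; length)
open import Data.List.Membership.Propositional using (_∈_)
open import Data.List.Relation.Unary.All using (All)
open import Data.List.Relation.Unary.Unique.Propositional using (Unique)
open import Data.Product using (Σ; _×_; _,_; proj₁; proj₂)
open import Data.Sum using (_⊎_)
open import Data.Empty using (⊥)
open import Data.Unit using (⊤)
open import Function using (_∘_)
open import Function.Definitions using (Injective)
open import Relation.Nullary using (¬_)
open import Relation.Binary.PropositionalEquality using (_≡_; _≢_)

data Formula : Set where
  one  : Formula
  bot  : Formula
  var  : ℕ → Formula
  nvar : ℕ → Formula
  _⊗_  : Formula → Formula → Formula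
  _⅋_  : Formula → Formula → Formula

dual : Formula → Formula
dual one      = bot
dual bot      = one
dual (var x)  = nvar x
dual (nvar x) = var x
dual (A ⊗ B)  = dual A ⅋ dual B
dual (A ⅋ B)  = dual A ⊗ dual B

data Pos : Formula → Set where
  one : Pos one
  _⊗_ : ∀ {P Q} → Pos P → Pos Q → Pos (P ⊗ Q)

data Neg : Formula → Set where
  bot : Neg bot
  _⅋_ : ∀ {N M} → Neg N → Neg M → Neg (N ⅋ M)

data BotFree : Formula → Set where
  one  : BotFree one
  var  : ∀ x → BotFree (var x)
  nvar : ∀ x → BotFree (nvar x)
  _⊗_  : ∀ {A B} → BotFree A → BotFree B → BotFree (A ⊗ B)
  _⅋_  : ∀ {A B} → BotFree A → BotFree B → BotFree (A ⅋ B)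

-- SMLL proof structures (with boxes), as hypergraphs.
-- A net has e edges (Fin e), each typed by a formula, m links (Fin m),
-- and an ordered list of conclusion edges.

mutual
  data Link (e : ℕ) : Set where
    axL   : Fin e → Fin e → Link e
    cutL  : Fin e → Fin e → Link e
    tensL : Fin e → Fin e → Fin e → Link e
    parL  : Fin e → Fin e → Fin e → Link e
    oneL  : Fin e → Link e
    syncL : List (Fin e × Fin e) → Link e          -- list of (i-th premiss , i-th conclusion)
    boxL  : Fin e → List (Fin e) → Net → Link e    -- bot link: lock ⊥, conclusions Γ, box content

  data Net : Set where
    net : (e m : ℕ) → (Fin e → Formula) → (Fin m → Link e) → List (Fin e) → Net

prems : ∀ {e} → Link e → List (Fin e)
prems (axL a b)      = []
prems (cutL a b)     = a ∷ b ∷ []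
prems (tensL a b c)  = a ∷ b ∷ []
prems (parL a b c)   = a ∷ b ∷ []
prems (oneL c)       = []
prems (syncL ps)     = map proj₁ ps
prems (boxL l Γ M)   = []

concls : ∀ {e} → Link e → List (Fin e)
concls (axL a b)     = a ∷ b ∷ []
concls (cutL a b)    = []
concls (tensL a b c) = c ∷ []
concls (parL a b c)  = c ∷ []
concls (oneL c)      = c ∷ []
concls (syncL ps)    = map proj₂ ps
concls (boxL l Γ M)  = l ∷ Γ

occ : ∀ {e} → Fin e → List (Fin e) → ℕ
occ x xs = length (filter (_≟ x) xs)

conclTypes : Net → List Formula
conclTypes (net e m ty ls cs) = map ty cs

data LinkTyped {e : ℕ} (ty : Fin e → Formula) : Link e → Set where
  axT   : ∀ {a b} → ty b ≡ dual (ty a) → LinkTyped ty (axL a b)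
  cutT  : ∀ {a b} → ty b ≡ dual (ty a) → LinkTyped ty (cutL a b)
  tensT : ∀ {a b c} → ty c ≡ (ty a ⊗ ty b) → LinkTyped ty (tensL a b c)
  parT  : ∀ {a b c} → ty c ≡ (ty a ⅋ ty b) → LinkTyped ty (parL a b c)
  oneT  : ∀ {c} → ty c ≡ one → LinkTyped ty (oneL c)
  syncT : ∀ {ps} →
          All (λ pq → ty (proj₁ pq) ≡ ty (proj₂ pq) × (Pos (ty (proj₁ pq)) ⊎ Neg (ty (proj₁ pq)))) ps →
          LinkTyped ty (syncL ps)
  boxT  : ∀ {l Γ M} → ty l ≡ bot → map ty Γ ≡ conclTypes M → LinkTyped ty (boxL l Γ M)

record WF0 {e m : ℕ} (ty : Fin e → Formula) (ls : Fin m → Link e) (cs : List (Fin e)) : Set where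
  field
    typed     : ∀ v → LinkTyped ty (ls v)
    conclOnce : ∀ x → occ x (concatMap (concls ∘ ls) (allFin m)) ≡ 1
    premAtMostOnce : ∀ x → occ x (concatMap (prems ∘ ls) (allFin m)) ≤ 1
    conclsUnique : Unique cs
    conclsFree   : ∀ x → (x ∈ cs → occ x (concatMap (prems ∘ ls) (allFin m)) ≡ 0)
                       × (occ x (concatMap (prems ∘ ls) (allFin m)) ≡ 0 → x ∈ cs)

-- Switching cycles in the 0-graph (boxes are single nodes = box links)

data Dir : Set where
  down up : Dir

data Role : Set where
  premR conclR : Role

record Step (e m : ℕ) : Set where
  constructor step
  field
    edge : Fin e
    dir  : Dir
    from : Fin m
    to   : Fin m
open Step public

ValidStep : ∀ {e m} → (Fin m → Link e) → Step e m → Set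
ValidStep ls (step x down v w) = (x ∈ concls (ls v)) × (x ∈ prems (ls w))
ValidStep ls (step x up v w)   = (x ∈ prems (ls v)) × (x ∈ concls (ls w))

arrRole : Dir → Role
arrRole down = premR
arrRole up   = conclR

depRole : Dir → Role
depRole down = conclR
depRole up   = premR

Out : ∀ {e} → (Fin e → Formula) → Fin e → Role → Set
Out ty x premR  = Neg (ty x)
Out ty x conclR = Pos (ty x)

Switch : ∀ {e} → (Fin e → Formula) → Link e → Fin e → Role → Fin e → Role → Set
Switch ty (parL a b c) x r y s = ¬ (r ≡ premR × s ≡ premR)
Switch ty (syncL ps)   x r y s = ¬ (Out ty x r × Out ty y s)
Switch ty _            x r y s = ⊤

CycSucc : ∀ {k} → Fin (suc k) → Fin (suc k) → Set
CycSucc {k} i j = (toℕ j ≡ suc (toℕ i)) ⊎ (toℕ i ≡ k × toℕ j ≡ 0)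

record SwitchingCycle {e m : ℕ} (ty : Fin e → Formula) (ls : Fin m → Link e) : Set where
  field
    len   : ℕ
    st    : Fin (suc len) → Step e m
    valid : ∀ i → ValidStep ls (st i)
    chain : ∀ i j → CycSucc i j →
              (to (st i) ≡ from (st j))
              × Switch ty (ls (to (st i))) (edge (st i)) (arrRole (dir (st i)))
                                           (edge (st j)) (depRole (dir (st j)))
    edgesDistinct : Injective _≡_ _≡_ (edge ∘ st)
    nodesDistinct : Injective _≡_ _≡_ (from ∘ st)

mutual
  IsNet : Net → Set
  IsNet (net e m ty ls cs) =
    WF0 ty ls cs × ¬ SwitchingCycle ty ls × (∀ v → BoxContentsOK (ls v))

  BoxContentsOK : ∀ {e} → Link e → Set
  BoxContentsOK (boxL l Γ M) = IsNet M
  BoxContentsOK _            = ⊤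

Closed : Net → Set
Closed (net e m ty ls cs) = All (λ c → BotFree (ty c)) cs

mutual
  CutFree : Net → Set
  CutFree (net e m ty ls cs) = ∀ v → LinkCutFree (ls v)

  LinkCutFree : ∀ {e} → Link e → Set
  LinkCutFree (cutL a b)   = ⊥
  LinkCutFree (boxL l Γ M) = CutFree M
  LinkCutFree _            = ⊤

-- Redexes of the lazy reduction → (depth 0 only)

CutOn : ∀ {e} → Link e → Fin e → Fin e → Set
CutOn l p q = (l ≡ cutL p q) ⊎ (l ≡ cutL q p)

AxOn : ∀ {e} → Link e → Fin e → Fin e → Set
AxOn l p r = (l ≡ axL p r) ⊎ (l ≡ axL r p)

TensConcl : ∀ {e} → Link e → Fin e → Set
TensConcl l c = Σ _ λ a → Σ _ λ b → l ≡ tensL a b c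

ParConcl : ∀ {e} → Link e → Fin e → Set
ParConcl l c = Σ _ λ a → Σ _ λ b → l ≡ parL a b c

SyncPrem : ∀ {e} → Link e → Fin e → Set
SyncPrem l p = Σ _ λ ps → (l ≡ syncL ps) × Σ _ λ q → (p , q) ∈ ps

SyncConcl : ∀ {e} → Link e → Fin e → Set
SyncConcl l q = Σ _ λ ps → (l ≡ syncL ps) × Σ _ λ p → (p , q) ∈ ps

data Redex0 {e m : ℕ} (ty : Fin e → Formula) (ls : Fin m → Link e) : Set where
  axCut   : ∀ c a p q r → CutOn (ls c) p q → AxOn (ls a) p r → r ≢ q → Redex0 ty ls
  tensPar : ∀ c t s p q → CutOn (ls c) p q → TensConcl (ls t) p → ParConcl (ls s) q → Redex0 ty ls
  -- pushing a sync above a ⊗ or ⅋ link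
  syncTP  : ∀ s t p → SyncPrem (ls s) p → TensConcl (ls t) p ⊎ ParConcl (ls t) p → Redex0 ty ls
  -- moving a sync from the positive conclusion of an axiom to the other one
  syncAx  : ∀ s a p r → SyncPrem (ls s) p → Pos (ty p) → AxOn (ls a) p r → Redex0 ty ls
  -- moving a sync from the (negative) premiss P^⊥ of a cut to the other one
  syncCut : ∀ s c p q → SyncConcl (ls s) p → Neg (ty p) → CutOn (ls c) p q → Redex0 ty ls
  -- erasing a sync whose premisses are all conclusions of one links
  syncOne : ∀ s ps → ls s ≡ syncL ps → All (λ pq → Σ (Fin m) λ o → ls o ≡ oneL (proj₁ pq)) ps → Redex0 ty ls
  -- opening a box whose lock is cut against a one link
  boxOpen : ∀ c b o l Γ M p → CutOn (ls c) l p → ls b ≡ boxL l Γ M → ls o ≡ oneL p → Redex0 ty ls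

NormalForm : Net → Set
NormalForm (net e m ty ls cs) = ¬ Redex0 ty ls

module Submission where

-- Walk through the net starting from an edge containing ⊥: go down through ⊗ and ⅋
-- links, down out of a box through its lock, across a cut by going up its other
-- premiss, and out of a sync link through an edge that is not one of its out-edges.
-- Closedness guarantees that an edge containing ⊥ always has a link below it, and every
-- configuration in which the walk could not go on is a redex of the lazy reduction.
-- In a normal net the walk therefore never stops, and on a finite net it closes into a
-- switching cycle of the 0-graph. The lock of a box and the premiss of a cut containing
-- ⊥ are such starting points, so there are no boxes at depth 0. A cut with an axiom
-- above it is a redex or a 2-cycle, and any other cut between two ⊥-free premisses is
-- a ⊗/⅋ redex, a one/box redex or ill-typed.

open import Data.Empty using (⊥; ⊥-elim)
open import Data.Fin using (Fin; toℕ; fromℕ; fromℕ<; combine) renaming (zero to fzero; suc to fsuc)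
open import Data.Fin.Properties using (_≟_; any?; pigeonhole; toℕ-injective; toℕ-inject; toℕ-fromℕ; toℕ-fromℕ<; toℕ≤pred[n]; toℕ<n; ¬∀⟶∃¬-smallest; combine-injective)
open import Data.List using (List; []; _∷_; _++_; concatMap; filter; length; allFin)
open import Data.List.Properties using (length-++; filter-++)
open import Data.List.Membership.Propositional using (_∈_)
open import Data.List.Membership.Propositional.Properties using (∈-allFin; ∈-map⁺; ∈-map⁻; ∈-concatMap⁻)
open import Data.List.Relation.Binary.Subset.Propositional using (_⊆_)
open import Data.List.Relation.Unary.All as All using (All)
open import Data.List.Relation.Unary.Any using (here; there; satisfied)
open import Data.Maybe using (Maybe; just; nothing; fromMaybe)
open import Data.Maybe.Properties using (just-injective)
open import Data.Nat using (ℕ; zero; suc; _+_; _*_; _≤_; _<_; z≤n; s≤s)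
open import Data.Nat.GeneralisedArithmetic using (fold)
open import Data.Nat.Properties using (n<1+n; +-suc; +-identityʳ; +-cancelˡ-≡; +-monoʳ-≤; +-mono-≤; +-comm; <-cmp; m≤n⇒∃[o]m+o≡n; ≤-trans; ≤-refl; ≤-reflexive; m≤m+n; m≤n+m)
open import Data.Product using (∃; ∃-syntax; _×_; _,_; proj₁; proj₂)
open import Data.Sum using (_⊎_; inj₁; inj₂; [_,_]′; map₁)
open import Data.Unit using (⊤; tt)
open import Function using (_∘_; id; case_of_)
open import Function.Definitions using (Injective)
open import Relation.Binary.Definitions using (tri<; tri≈; tri>)
open import Relation.Binary.PropositionalEquality using (_≡_; _≢_; refl; sym; trans; cong; cong₂; subst; module ≡-Reasoning)
open import Relation.Nullary using (¬_; ¬?; Dec; yes; no)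
open import Relation.Nullary.Decidable using (map′; decidable-stable)
open import Relation.Unary using (Decidable)
open import Defs

dual-involutive : ∀ A → dual (dual A) ≡ A
dual-involutive one      = refl
dual-involutive bot      = refl
dual-involutive (var x)  = refl
dual-involutive (nvar x) = refl
dual-involutive (A ⊗ B)  = cong₂ _⊗_ (dual-involutive A) (dual-involutive B)
dual-involutive (A ⅋ B)  = cong₂ _⅋_ (dual-involutive A) (dual-involutive B)

dual-≢ : ∀ A → dual A ≢ A
dual-≢ one      ()
dual-≢ bot      ()
dual-≢ (var _)  ()
dual-≢ (nvar _) ()
dual-≢ (A ⊗ B)  ()
dual-≢ (A ⅋ B)  ()

Pos⇒BotFree : ∀ {A} → Pos A → BotFree A
Pos⇒BotFree one     = one
Pos⇒BotFree (p ⊗ q) = Pos⇒BotFree p ⊗ Pos⇒BotFree q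

Neg⇒¬BotFree : ∀ {A} → Neg A → ¬ BotFree A
Neg⇒¬BotFree bot     ()
Neg⇒¬BotFree (n ⅋ _) (a ⅋ _) = Neg⇒¬BotFree n a

Pos∧Neg⇒⊥ : ∀ {A} → Pos A → Neg A → ⊥
Pos∧Neg⇒⊥ p n = Neg⇒¬BotFree n (Pos⇒BotFree p)

Pos⇒Neg-dual : ∀ {A} → Pos A → Neg (dual A)
Pos⇒Neg-dual one     = bot
Pos⇒Neg-dual (p ⊗ q) = Pos⇒Neg-dual p ⅋ Pos⇒Neg-dual q

Neg⇒Pos-dual : ∀ {A} → Neg A → Pos (dual A)
Neg⇒Pos-dual bot     = one
Neg⇒Pos-dual (n ⅋ m) = Neg⇒Pos-dual n ⊗ Neg⇒Pos-dual m

BotFree-⊗⁻ : ∀ {A B} → BotFree (A ⊗ B) → BotFree A × BotFree B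
BotFree-⊗⁻ (a ⊗ b) = a , b

BotFree-⅋⁻ : ∀ {A B} → BotFree (A ⅋ B) → BotFree A × BotFree B
BotFree-⅋⁻ (a ⅋ b) = a , b

pos? : ∀ A → Dec (Pos A)
pos? one      = yes one
pos? bot      = no λ ()
pos? (var _)  = no λ ()
pos? (nvar _) = no λ ()
pos? (_ ⅋ _)  = no λ ()
pos? (A ⊗ B) with pos? A | pos? B
... | yes a | yes b = yes (a ⊗ b)
... | no ¬a | _     = no λ { (a ⊗ _) → ¬a a }
... | yes _ | no ¬b = no λ { (_ ⊗ b) → ¬b b }

botFree? : ∀ A → Dec (BotFree A)
botFree? one      = yes one
botFree? bot      = no λ ()
botFree? (var x)  = yes (var x)
botFree? (nvar x) = yes (nvar x)
botFree? (A ⊗ B) with botFree? A | botFree? B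
... | yes a | yes b = yes (a ⊗ b)
... | no ¬a | _     = no λ { (a ⊗ _) → ¬a a }
... | yes _ | no ¬b = no λ { (_ ⊗ b) → ¬b b }
botFree? (A ⅋ B) with botFree? A | botFree? B
... | yes a | yes b = yes (a ⅋ b)
... | no ¬a | _     = no λ { (a ⅋ _) → ¬a a }
... | yes _ | no ¬b = no λ { (_ ⅋ b) → ¬b b }

module _ {e : ℕ} where

  occ-++ : ∀ (x : Fin e) xs ys → occ x (xs ++ ys) ≡ occ x xs + occ x ys
  occ-++ x xs ys = trans (cong length (filter-++ (_≟ x) xs ys)) (length-++ (filter (_≟ x) xs))

  ∈⇒1≤occ : ∀ {x : Fin e} {xs} → x ∈ xs → 1 ≤ occ x xs
  ∈⇒1≤occ {x} {y ∷ ys} x∈ with y ≟ x | x∈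
  ... | yes _ | _          = s≤s z≤n
  ... | no y≢x | here x≡y  = ⊥-elim (y≢x (sym x≡y))
  ... | no _  | there x∈ys = ∈⇒1≤occ x∈ys

  occ≢0⇒∈ : ∀ {x : Fin e} xs → occ x xs ≢ 0 → x ∈ xs
  occ≢0⇒∈ [] occ≢0 = ⊥-elim (occ≢0 refl)
  occ≢0⇒∈ {x} (y ∷ ys) occ≢0 with y ≟ x
  ... | yes refl = here refl
  ... | no _     = there (occ≢0⇒∈ ys occ≢0)

  module _ {A : Set} (g : A → List (Fin e)) (x : Fin e) where

    occ-concatMap-≥ : ∀ {v} L → v ∈ L → occ x (g v) ≤ occ x (concatMap g L)
    occ-concatMap-≥ (u ∷ L) v∈ rewrite occ-++ x (g u) (concatMap g L) with v∈
    ... | here refl  = m≤m+n _ _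
    ... | there v∈L = ≤-trans (occ-concatMap-≥ L v∈L) (m≤n+m _ _)

    occ-concatMap-≥₂ : ∀ {v w} L → v ∈ L → w ∈ L → v ≢ w →
                       occ x (g v) + occ x (g w) ≤ occ x (concatMap g L)
    occ-concatMap-≥₂ {v} (u ∷ L) v∈ w∈ v≢w rewrite occ-++ x (g u) (concatMap g L) with v∈ | w∈
    ... | here refl  | here refl  = ⊥-elim (v≢w refl)
    ... | here refl  | there w∈L = +-mono-≤ ≤-refl (occ-concatMap-≥ L w∈L)
    ... | there v∈L | here refl  =
      subst (_≤ occ x (g u) + occ x (concatMap g L)) (+-comm (occ x (g u)) (occ x (g v)))
            (+-mono-≤ ≤-refl (occ-concatMap-≥ L v∈L))
    ... | there v∈L | there w∈L = ≤-trans (occ-concatMap-≥₂ L v∈L w∈L v≢w) (m≤n+m _ _)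

  concatMap-occ≤1⇒unique : ∀ {m} (g : Fin m → List (Fin e)) {x} → occ x (concatMap g (allFin m)) ≤ 1 →
                           ∀ {v w} → x ∈ g v → x ∈ g w → v ≡ w
  concatMap-occ≤1⇒unique g {x} occ≤1 {v} {w} x∈v x∈w with v ≟ w
  ... | yes v≡w = v≡w
  ... | no v≢w  = case ≤-trans (+-mono-≤ (∈⇒1≤occ x∈v) (∈⇒1≤occ x∈w))
                              (≤-trans (occ-concatMap-≥₂ g x _ (∈-allFin v) (∈-allFin w) v≢w) occ≤1)
                   of λ { (s≤s ()) }

least-witness : {P : ℕ → Set} → Decidable P → ∀ {n} → P n → ∃[ k ] P k × (∀ {j} → j < k → ¬ P j)
least-witness {P} P? {n} pn
  with ¬∀⟶∃¬-smallest (suc n) (¬_ ∘ P ∘ toℕ) (¬? ∘ P? ∘ toℕ)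
         (λ ¬P → ¬P (fromℕ n) (subst P (sym (toℕ-fromℕ n)) pn))
... | k , ¬¬pk , below =
  toℕ k , decidable-stable (P? (toℕ k)) ¬¬pk ,
  λ j<k → subst (¬_ ∘ P) (trans (toℕ-inject _) (toℕ-fromℕ< j<k)) (below (fromℕ< j<k))

module Orbit {S : Set} {k : ℕ} (code : S → Fin k) (code-injective : Injective _≡_ _≡_ code)
             (next : S → S) (s₀ : S) where

  orbit : ℕ → S
  orbit = fold s₀ next

  Repeat : ℕ → Set
  Repeat j = ∃[ i ] i < j × orbit i ≡ orbit j

  repeat? : Decidable Repeat
  repeat? j = map′ (λ (i , eq) → toℕ i , toℕ<n i , code-injective eq)
                   (λ (i , i<j , eq) → fromℕ< i<j , cong code (trans (cong orbit (toℕ-fromℕ< i<j)) eq))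
                   (any? λ (i : Fin j) → code (orbit (toℕ i)) ≟ code (orbit j))

  some-repeat : ∃ Repeat
  some-repeat with pigeonhole (n<1+n k) (code ∘ orbit ∘ toℕ)
  ... | i , j , i<j , eq = toℕ j , toℕ i , i<j , code-injective eq

  record Cycle : Set where
    field
      start len : ℕ
      closes    : orbit (suc (start + len)) ≡ orbit start
      distinct  : ∀ {a b} → a ≤ len → b ≤ len → orbit (start + a) ≡ orbit (start + b) → a ≡ b

  cycle : Cycle
  cycle with least-witness repeat? (proj₂ some-repeat)
  ... | J , (I , I<J , orbitI≡orbitJ) , first with m≤n⇒∃[o]m+o≡n I<J
  ... | L , refl = record
    { start = I ; len = L ; closes = sym orbitI≡orbitJ ; distinct = distinct }
    where
    below : ∀ {a} → a ≤ L → I + a < suc (I + L)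
    below a≤L = s≤s (+-monoʳ-≤ I a≤L)

    distinct : ∀ {a b} → a ≤ L → b ≤ L → orbit (I + a) ≡ orbit (I + b) → a ≡ b
    distinct {a} {b} a≤L b≤L eq with <-cmp (I + a) (I + b)
    ... | tri< lt _ _ = ⊥-elim (first (below b≤L) (I + a , lt , eq))
    ... | tri≈ _ same _ = +-cancelˡ-≡ I a b same
    ... | tri> _ _ gt = ⊥-elim (first (below a≤L) (I + b , gt , sym eq))

Consecutive : ∀ {e m} → (Fin e → Formula) → (Fin m → Link e) → Step e m → Step e m → Set
Consecutive ty ls s t =
  (to s ≡ from t) × Switch ty (ls (to s)) (edge s) (arrRole (dir s)) (edge t) (depRole (dir t))

module _ {e m : ℕ} (ty : Fin e → Formula) (ls : Fin m → Link e)
         {S : Set} (toStep : S → Step e m) (next : S → S) (Inv : S → Set) where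

  record IsSwitchingWalk : Set where
    field
      next-Inv       : ∀ {s} → Inv s → Inv (next s)
      step-valid     : ∀ {s} → Inv s → ValidStep ls (toStep s)
      step-next      : ∀ {s} → Inv s → Consecutive ty ls (toStep s) (toStep (next s))
      next-by-target : ∀ {s t} → Inv s → Inv t → to (toStep s) ≡ to (toStep t) → next s ≡ next t
      edge-injective : ∀ {s t} → Inv s → Inv t → edge (toStep s) ≡ edge (toStep t) → s ≡ t

  module _ (walk : IsSwitchingWalk) {k} (code : S → Fin k) (code-injective : Injective _≡_ _≡_ code)
           {s₀ : S} (inv₀ : Inv s₀) where

    open IsSwitchingWalk walk
    open Orbit code code-injective next s₀

    private
      Inv-at : ∀ n → Inv (orbit n)
      Inv-at zero    = inv₀
      Inv-at (suc n) = next-Inv (Inv-at n)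

    cycle⇒SwitchingCycle : Cycle → SwitchingCycle ty ls
    cycle⇒SwitchingCycle C = record
      { len = len ; st = st ; valid = step-valid ∘ Inv-state ; chain = chain
      ; edgesDistinct = λ {i} {j} eq → index-injective (edge-injective (Inv-state i) (Inv-state j) eq)
      ; nodesDistinct = nodes-distinct }
      where
      open Cycle C

      state : Fin (suc len) → S
      state i = orbit (start + toℕ i)

      st : Fin (suc len) → Step e m
      st = toStep ∘ state

      Inv-state : ∀ i → Inv (state i)
      Inv-state i = Inv-at (start + toℕ i)

      index-injective : ∀ {i j} → state i ≡ state j → i ≡ j
      index-injective eq = toℕ-injective (distinct (toℕ≤pred[n] _) (toℕ≤pred[n] _) eq)

      next-state : ∀ i j → CycSucc i j → next (state i) ≡ state j
      next-state i j (inj₁ j≡1+i) rewrite j≡1+i = cong orbit (sym (+-suc start (toℕ i)))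
      next-state i j (inj₂ (i≡len , j≡0)) rewrite i≡len | j≡0 =
        trans closes (cong orbit (sym (+-identityʳ start)))

      chain : ∀ i j → CycSucc i j → Consecutive ty ls (st i) (st j)
      chain i j i→j = subst (Consecutive ty ls (st i) ∘ toStep) (next-state i j i→j) (step-next (Inv-state i))

      predecessor : ∀ i → ∃[ n ] next (orbit n) ≡ state i
      predecessor fzero    = start + len , trans closes (cong orbit (sym (+-identityʳ start)))
      predecessor (fsuc i) = start + toℕ i , cong orbit (sym (+-suc start (toℕ i)))

      arrives : ∀ n i → next (orbit n) ≡ state i → to (toStep (orbit n)) ≡ from (st i)
      arrives n i n→i = trans (proj₁ (step-next (Inv-at n))) (cong (from ∘ toStep) n→i)

      nodes-distinct : ∀ {i j} → from (st i) ≡ from (st j) → i ≡ j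
      nodes-distinct {i} {j} eq with predecessor i | predecessor j
      ... | p , p→i | q , q→j = index-injective (begin
        state i          ≡⟨ sym p→i ⟩
        next (orbit p)   ≡⟨ next-by-target (Inv-at p) (Inv-at q) same-target ⟩
        next (orbit q)   ≡⟨ q→j ⟩
        state j          ∎)
        where
        open ≡-Reasoning
        same-target : to (toStep (orbit p)) ≡ to (toStep (orbit q))
        same-target = trans (arrives p i p→i) (trans eq (sym (arrives q j q→j)))

    switchingWalk⇒SwitchingCycle : SwitchingCycle ty ls
    switchingWalk⇒SwitchingCycle = cycle⇒SwitchingCycle cycle

CutOn-sym : ∀ {e} {l : Link e} {x y} → CutOn l x y → CutOn l y x
CutOn-sym (inj₁ eq) = inj₂ eq
CutOn-sym (inj₂ eq) = inj₁ eq

oneLink? : ∀ {e} (l : Link e) (x : Fin e) → Dec (l ≡ oneL x)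
oneLink? (oneL c)      x with c ≟ x
... | yes refl = yes refl
... | no c≢x   = no λ { refl → c≢x refl }
oneLink? (axL _ _)     x = no λ ()
oneLink? (cutL _ _)    x = no λ ()
oneLink? (tensL _ _ _) x = no λ ()
oneLink? (parL _ _ _)  x = no λ ()
oneLink? (syncL _)     x = no λ ()
oneLink? (boxL _ _ _)  x = no λ ()

data Principal {e} (x : Fin e) : Link e → Set where
  tens : ∀ {a b} → Principal x (tensL a b x)
  par  : ∀ {a b} → Principal x (parL a b x)
  one  : Principal x (oneL x)
  lock : ∀ {Γ M} → Principal x (boxL x Γ M)

Dir-code : Dir → Fin 2
Dir-code down = fzero
Dir-code up   = fsuc fzero

Dir-code-injective : ∀ {d d′} → Dir-code d ≡ Dir-code d′ → d ≡ d′
Dir-code-injective {down} {down} _ = refl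
Dir-code-injective {up}   {up}   _ = refl

module ClosedNormalNet {e m : ℕ} (ty : Fin e → Formula) (ls : Fin m → Link e) (cs : List (Fin e))
  (wf : WF0 ty ls cs) (closed : All (BotFree ∘ ty) cs) (normal : ¬ Redex0 ty ls) where

  open WF0 wf
  open import Data.List.Membership.DecPropositional (_≟_ {e}) using (_∈?_)

  concluding-link : ∀ x → ∃[ v ] x ∈ concls (ls v)
  concluding-link x = satisfied (∈-concatMap⁻ (concls ∘ ls) {xs = allFin m} (occ≢0⇒∈ _ λ occ≡0 →
    case trans (sym occ≡0) (conclOnce x) of λ ()))

  above : Fin e → Fin m
  above = proj₁ ∘ concluding-link

  above-concl : ∀ x → x ∈ concls (ls (above x))
  above-concl = proj₂ ∘ concluding-link

  above-unique : ∀ {x v} → x ∈ concls (ls v) → above x ≡ v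
  above-unique {x} = concatMap-occ≤1⇒unique (concls ∘ ls) (≤-reflexive (conclOnce x)) (above-concl x)

  above-concl-at : ∀ {x l} → ls (above x) ≡ l → x ∈ concls l
  above-concl-at {x} ex = subst (λ l → x ∈ concls l) ex (above-concl x)

  -- A conclusion of the net has no link below it; `below` is junk there.
  below : Fin e → Fin m
  below x with any? (λ v → x ∈? prems (ls v))
  ... | yes (v , _) = v
  ... | no _        = above x

  below-unique : ∀ {x v} → x ∈ prems (ls v) → below x ≡ v
  below-unique {x} x∈ with any? (λ v → x ∈? prems (ls v))
  ... | yes (_ , x∈′) = concatMap-occ≤1⇒unique (prems ∘ ls) (premAtMostOnce x) x∈′ x∈
  ... | no ∄v         = ⊥-elim (∄v (_ , x∈))

  below-prem : ∀ {x v} → x ∈ prems (ls v) → x ∈ prems (ls (below x))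
  below-prem {x} x∈ = subst (λ v → x ∈ prems (ls v)) (sym (below-unique x∈)) x∈

  ¬BotFree⇒premiss : ∀ {x} → ¬ BotFree (ty x) → ∃[ v ] x ∈ prems (ls v)
  ¬BotFree⇒premiss {x} hot = satisfied (∈-concatMap⁻ (prems ∘ ls) {xs = allFin m} (occ≢0⇒∈ _ λ occ≡0 →
    hot (All.lookup closed (proj₂ (conclsFree x) occ≡0))))

  hot⇒below-prem : ∀ {x} → ¬ BotFree (ty x) → x ∈ prems (ls (below x))
  hot⇒below-prem = below-prem ∘ proj₂ ∘ ¬BotFree⇒premiss

  typedAt : ∀ {v l} → ls v ≡ l → LinkTyped ty l
  typedAt {v} ev = subst (LinkTyped ty) ev (typed v)

  cut-types : ∀ {c x y} → CutOn (ls c) x y → ty y ≡ dual (ty x)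
  cut-types (inj₁ ec) with typedAt ec
  ... | cutT ty≡ = ty≡
  cut-types {x = x} {y} (inj₂ ec) with typedAt ec
  ... | cutT ty≡ = trans (sym (dual-involutive (ty y))) (cong dual (sym ty≡))

  cut-dual : ∀ {c x y} → CutOn (ls c) x y → ty x ≡ dual (ty y)
  cut-dual = cut-types ∘ CutOn-sym

  cut-premisses-distinct : ∀ {c x y} → CutOn (ls c) x y → x ≢ y
  cut-premisses-distinct {x = x} cut refl = dual-≢ (ty x) (sym (cut-types cut))

  sync-polarity : ∀ {v ps p q} → ls v ≡ syncL ps → (p , q) ∈ ps → ty p ≡ ty q × (Pos (ty q) ⊎ Neg (ty q))
  sync-polarity ev pq∈ with typedAt ev
  ... | syncT pairs with All.lookup pairs pq∈
  ...   | p≡q , inj₁ pos = p≡q , inj₁ (subst Pos p≡q pos)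
  ...   | p≡q , inj₂ neg = p≡q , inj₂ (subst Neg p≡q neg)

  State : Set
  State = Fin e × Dir

  toStep : State → Step e m
  toStep (x , down) = step x down (above x) (below x)
  toStep (y , up)   = step y up (below y) (above y)

  DownFrom : Link e → Fin e → Set
  DownFrom (axL _ _)    _ = ⊥
  DownFrom (boxL l _ _) x = x ≡ l
  DownFrom _            _ = ⊤

  UpInto : Link e → Fin e → Set
  UpInto (boxL l _ _) y = y ≢ l
  UpInto (syncL _)    y = Pos (ty y)
  UpInto _            _ = ⊥

  -- No edge is walked in both directions: descending edges contain ⊥, while an
  -- ascending edge is a positive sync conclusion or a box conclusion other than the lock.
  Admissible : State → Set
  Admissible (x , down) = ¬ BotFree (ty x) × DownFrom (ls (above x)) x
  Admissible (y , up)   = UpInto (ls (above y)) y × ∃[ v ] y ∈ prems (ls v)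

  DownFrom∧UpInto⇒⊥ : ∀ {x} (l : Link e) → ¬ BotFree (ty x) → DownFrom l x → UpInto l x → ⊥
  DownFrom∧UpInto⇒⊥ (boxL _ _ _) _   x≡l x≢l = x≢l x≡l
  DownFrom∧UpInto⇒⊥ (syncL _)    hot _   pos = hot (Pos⇒BotFree pos)

  exitThrough : Fin e → Fin e → State
  exitThrough p q with pos? (ty p)
  ... | yes _ = p , up
  ... | no _  = q , down

  syncExit : List (Fin e × Fin e) → Maybe State
  syncExit [] = nothing
  syncExit ((p , q) ∷ ps) with oneLink? (ls (above p)) p
  ... | yes _ = syncExit ps
  ... | no _  = just (exitThrough p q)

  exitLink : Link e → Maybe State
  exitLink (tensL _ _ c) = just (c , down)
  exitLink (parL _ _ c)  = just (c , down)
  exitLink (boxL l _ _)  = just (l , down)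
  exitLink (syncL ps)    = syncExit ps
  exitLink _             = nothing

  crossLink : Fin e → Link e → Maybe State
  crossLink x (cutL a b) with x ≟ a
  ... | yes _ = just (b , up)
  ... | no _  = just (a , up)
  crossLink x l = exitLink l

  successor : State → Maybe State
  successor (x , down) = crossLink x (ls (below x))
  successor (y , up)   = exitLink (ls (above y))

  next : State → State
  next s = fromMaybe s (successor s)

  -- Leaving a sync link through an in-edge respects the switching condition whatever
  -- edge the walk arrived by.
  Departs : Fin m → State → Set
  Departs v s = Admissible s × v ≡ from (toStep s) × ¬ Out ty (edge (toStep s)) (depRole (dir (toStep s)))

  Leaves : Fin m → Link e → Fin e → Role → Maybe State → Set
  Leaves v l x r exit = ∃[ s ] exit ≡ just s × Admissible s × v ≡ from (toStep s) ×
                                Switch ty l x r (edge (toStep s)) (depRole (dir (toStep s)))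

  sync-concl-polarity : ∀ {v ps y} → ls v ≡ syncL ps → y ∈ concls (syncL ps) → Pos (ty y) ⊎ Neg (ty y)
  sync-concl-polarity ev y∈ with ∈-map⁻ proj₂ y∈
  ... | _ , py∈ , refl = proj₂ (sync-polarity ev py∈)

  down-from : ∀ {v c l} → ls v ≡ l → c ∈ concls l → DownFrom l c → ¬ BotFree (ty c) →
              Admissible (c , down) × v ≡ above c
  down-from {v} {c} ev c∈ exit hot =
    (hot , subst (λ l → DownFrom l c) (sym (trans (cong ls v≡above) ev)) exit) , sym v≡above
    where
    v≡above : above c ≡ v
    v≡above = above-unique (subst (λ l → c ∈ concls l) (sym ev) c∈)

  sync-premiss-up : ∀ {v ps p q} → ls v ≡ syncL ps → (p , q) ∈ ps → Pos (ty p) → ls (above p) ≢ oneL p →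
                    UpInto (ls (above p)) p
  sync-premiss-up {v} {ps} {p} {q} ev pq∈ pos ¬one with ls (above p) in ep
  ... | axL a b = case above-concl-at ep of λ
    { (here refl)         → normal (syncAx v (above p) p b (ps , ev , q , pq∈) pos (inj₁ ep))
    ; (there (here refl)) → normal (syncAx v (above p) p a (ps , ev , q , pq∈) pos (inj₂ ep)) }
  ... | tensL a b c = case above-concl-at ep of λ
    { (here refl) → normal (syncTP v (above p) p (ps , ev , q , pq∈) (inj₁ (a , b , ep))) }
  ... | parL a b c = case above-concl-at ep of λ
    { (here refl) → normal (syncTP v (above p) p (ps , ev , q , pq∈) (inj₂ (a , b , ep))) }
  ... | oneL c = case above-concl-at ep of λ { (here refl) → ¬one refl }
  ... | cutL _ _ = case above-concl-at ep of λ ()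
  ... | syncL _ = pos
  ... | boxL l _ _ with typedAt ep
  ...   | boxT l-bot _ = λ { refl → case subst Pos l-bot pos of λ () }

  pair-departs : ∀ {v ps p q} → ls v ≡ syncL ps → (p , q) ∈ ps → ls (above p) ≢ oneL p →
                 Departs v (exitThrough p q)
  pair-departs {v} {ps} {p} {q} ev pq∈ ¬one with pos? (ty p) | sync-polarity ev pq∈
  ... | yes pos | _ = (sync-premiss-up ev pq∈ pos ¬one , v , p∈) , sym (below-unique p∈) , Pos∧Neg⇒⊥ pos
    where
    p∈ : p ∈ prems (ls v)
    p∈ = subst (λ l → p ∈ prems l) (sym ev) (∈-map⁺ proj₁ pq∈)
  ... | no ¬pos | p≡q , inj₁ pos = ⊥-elim (¬pos (subst Pos (sym p≡q) pos))
  ... | no ¬pos | p≡q , inj₂ neg with down-from ev (∈-map⁺ proj₂ pq∈) tt (Neg⇒¬BotFree neg)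
  ...   | admissible , v≡ = admissible , v≡ , ¬pos ∘ subst Pos (sym p≡q)

  OneAbove : Fin e × Fin e → Set
  OneAbove (p , _) = ∃[ o ] ls o ≡ oneL p

  sync-departs : ∀ {v ps} → ls v ≡ syncL ps → ∃[ s ] syncExit ps ≡ just s × Departs v s
  sync-departs {v} {ps} ev = [ (λ ones → ⊥-elim (normal (syncOne v ps ev ones))) , id ]′ (search ps id)
    where
    search : ∀ qs → qs ⊆ ps → All OneAbove qs ⊎ ∃[ s ] syncExit qs ≡ just s × Departs v s
    search [] _ = inj₁ All.[]
    search ((p , q) ∷ qs) qs⊆ps with oneLink? (ls (above p)) p
    ... | yes is-one = map₁ ((above p , is-one) All.∷_) (search qs (qs⊆ps ∘ there))
    ... | no ¬one = inj₂ (exitThrough p q , refl , pair-departs ev (qs⊆ps (here refl)) ¬one)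

  sync-leaves : ∀ {v ps x r} → ls v ≡ syncL ps → Leaves v (syncL ps) x r (syncExit ps)
  sync-leaves ev with sync-departs ev
  ... | s , exit , admissible , v≡ , ¬out = s , exit , admissible , v≡ , ¬out ∘ proj₂

  axiom-cut : ∀ {c u x y p r} → CutOn (ls c) x y → ls u ≡ axL p r → x ∈ concls (axL p r) →
              y ∈ concls (axL p r)
  axiom-cut {y = y} {r = r} cut eu (here refl) with r ≟ y
  ... | yes refl = there (here refl)
  ... | no r≢y   = ⊥-elim (normal (axCut _ _ _ _ r cut (inj₁ eu) r≢y))
  axiom-cut {y = y} {p = p} cut eu (there (here refl)) with p ≟ y
  ... | yes refl = here refl
  ... | no p≢y   = ⊥-elim (normal (axCut _ _ _ _ p cut (inj₂ eu) p≢y))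

  principal-cut : ∀ {c x y u w lu lw} → CutOn (ls c) x y →
                  ls u ≡ lu → Principal x lu → ls w ≡ lw → Principal y lw → ⊥
  principal-cut {c} {x} {y} {u} {w} cut eu pu ew pw = clash eu pu (typedAt eu) ew pw (typedAt ew)
    where
    opposite : ∀ {A B} → ty x ≡ A → ty y ≡ B → B ≡ dual A
    opposite tx ty′ = trans (sym ty′) (trans (cut-types cut) (cong dual tx))

    clash : ∀ {lu lw} → ls u ≡ lu → Principal x lu → LinkTyped ty lu →
                        ls w ≡ lw → Principal y lw → LinkTyped ty lw → ⊥
    clash eu tens _ ew par  _ = normal (tensPar c u w x y cut (_ , _ , eu) (_ , _ , ew))
    clash eu par  _ ew tens _ = normal (tensPar c w u y x (CutOn-sym cut) (_ , _ , ew) (_ , _ , eu))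
    clash eu lock _ ew one  _ = normal (boxOpen c u w x _ _ y cut eu ew)
    clash eu one  _ ew lock _ = normal (boxOpen c w u y _ _ x (CutOn-sym cut) ew eu)
    clash _ tens (tensT tx)  _ tens (tensT ty′)  = case opposite tx ty′ of λ ()
    clash _ tens (tensT tx)  _ one  (oneT ty′)   = case opposite tx ty′ of λ ()
    clash _ tens (tensT tx)  _ lock (boxT ty′ _) = case opposite tx ty′ of λ ()
    clash _ par  (parT tx)   _ par  (parT ty′)   = case opposite tx ty′ of λ ()
    clash _ par  (parT tx)   _ one  (oneT ty′)   = case opposite tx ty′ of λ ()
    clash _ par  (parT tx)   _ lock (boxT ty′ _) = case opposite tx ty′ of λ ()
    clash _ one  (oneT tx)   _ tens (tensT ty′)  = case opposite tx ty′ of λ ()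
    clash _ one  (oneT tx)   _ par  (parT ty′)   = case opposite tx ty′ of λ ()
    clash _ one  (oneT tx)   _ one  (oneT ty′)   = case opposite tx ty′ of λ ()
    clash _ lock (boxT tx _) _ tens (tensT ty′)  = case opposite tx ty′ of λ ()
    clash _ lock (boxT tx _) _ par  (parT ty′)   = case opposite tx ty′ of λ ()
    clash _ lock (boxT tx _) _ lock (boxT ty′ _) = case opposite tx ty′ of λ ()

  -- The last hypothesis rules out a positive sync conclusion x (whose dual y contains ⊥).
  cut-premiss-principal : ∀ {c x y} → CutOn (ls c) x y → DownFrom (ls (above x)) x →
                          ¬ BotFree (ty x) ⊎ BotFree (ty y) → Principal x (ls (above x))
  cut-premiss-principal {c} {x} {y} cut exit hot⊎cold with ls (above x) in ex
  ... | axL _ _     = ⊥-elim exit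
  ... | cutL _ _    = case above-concl-at ex of λ ()
  ... | tensL _ _ _ = case above-concl-at ex of λ { (here refl) → tens }
  ... | parL _ _ _  = case above-concl-at ex of λ { (here refl) → par }
  ... | oneL _      = case above-concl-at ex of λ { (here refl) → one }
  ... | boxL _ _ _  = case exit of λ { refl → lock }
  ... | syncL ps with ∈-map⁻ proj₂ (above-concl-at ex)
  ...   | (p , _) , px∈ , refl with sync-polarity ex px∈
  ...     | _ , inj₂ neg = ⊥-elim (normal (syncCut (above x) c x y (ps , ex , p , px∈) neg cut))
  ...     | _ , inj₁ pos = ⊥-elim ([ (λ hot → hot (Pos⇒BotFree pos)) , y-hot ]′ hot⊎cold)
    where
    y-hot : ¬ BotFree (ty y)
    y-hot = Neg⇒¬BotFree (subst Neg (sym (cut-types cut)) (Pos⇒Neg-dual pos))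

  hot-cut-principal : ∀ {c x y w lw} → CutOn (ls c) x y → ¬ BotFree (ty x) → DownFrom (ls (above x)) x →
                      ls w ≡ lw → Principal y lw → ⊥
  hot-cut-principal cut hot exit = principal-cut cut refl (cut-premiss-principal cut exit (inj₁ hot))

  cross-cut : ∀ {c x y} → CutOn (ls c) x y → ¬ BotFree (ty x) → DownFrom (ls (above x)) x →
              UpInto (ls (above y)) y
  cross-cut {c} {x} {y} cut hot exit with ls (above y) in ey
  ... | axL _ _ = subst (λ l → DownFrom l x) (trans (cong ls (above-unique x∈)) ey) exit
    where
    x∈ : x ∈ concls (ls (above y))
    x∈ = subst (λ l → x ∈ concls l) (sym ey) (axiom-cut (CutOn-sym cut) ey (above-concl-at ey))
  ... | cutL _ _    = case above-concl-at ey of λ ()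
  ... | tensL _ _ _ = case above-concl-at ey of λ { (here refl) → hot-cut-principal cut hot exit ey tens }
  ... | parL _ _ _  = case above-concl-at ey of λ { (here refl) → hot-cut-principal cut hot exit ey par }
  ... | oneL _      = case above-concl-at ey of λ { (here refl) → hot-cut-principal cut hot exit ey one }
  ... | syncL _ = [ id , (λ neg → ⊥-elim (hot (Pos⇒BotFree (subst Pos (sym (cut-dual cut)) (Neg⇒Pos-dual neg))))) ]′
                      (sync-concl-polarity ey (above-concl-at ey))
  ... | boxL l _ _ with y ≟ l | typedAt ey
  ...   | no y≢l   | _            = y≢l
  ...   | yes refl | boxT y-bot _ = ⊥-elim (hot (subst BotFree (sym (trans (cut-dual cut) (cong dual y-bot))) one))

  cut-premiss : ∀ {c x y} → CutOn (ls c) x y → y ∈ prems (ls c)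
  cut-premiss {y = y} (inj₁ ec) = subst (λ l → y ∈ prems l) (sym ec) (there (here refl))
  cut-premiss {y = y} (inj₂ ec) = subst (λ l → y ∈ prems l) (sym ec) (here refl)

  cross-to : ∀ {c x y} → CutOn (ls c) x y → ¬ BotFree (ty x) → DownFrom (ls (above x)) x →
             Admissible (y , up) × c ≡ below y
  cross-to {c} cut hot exit = (cross-cut cut hot exit , c , cut-premiss cut) , sym (below-unique (cut-premiss cut))

  ⊗-hot : ∀ {v a b c x} → ls v ≡ tensL a b c → x ∈ a ∷ b ∷ [] → ¬ BotFree (ty x) → ¬ BotFree (ty c)
  ⊗-hot ev x∈ hot c-cold with typedAt ev
  ... | tensT c≡ with BotFree-⊗⁻ (subst BotFree c≡ c-cold)
  ...   | a-cold , b-cold = hot (All.lookup (a-cold All.∷ b-cold All.∷ All.[]) x∈)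

  ⅋-hot : ∀ {v a b c x} → ls v ≡ parL a b c → x ∈ a ∷ b ∷ [] → ¬ BotFree (ty x) → ¬ BotFree (ty c)
  ⅋-hot ev x∈ hot c-cold with typedAt ev
  ... | parT c≡ with BotFree-⅋⁻ (subst BotFree c≡ c-cold)
  ...   | a-cold , b-cold = hot (All.lookup (a-cold All.∷ b-cold All.∷ All.[]) x∈)

  step-down : ∀ {x} → Admissible (x , down) → Leaves (below x) (ls (below x)) x premR (crossLink x (ls (below x)))
  step-down {x} (hot , exit) with ls (below x) in ev | hot⇒below-prem hot
  ... | axL _ _     | ()
  ... | oneL _      | ()
  ... | boxL _ _ _  | ()
  ... | syncL _     | _ = sync-leaves ev
  ... | tensL a b c | x∈ with down-from ev (here refl) tt (⊗-hot ev x∈ hot)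
  ...   | admissible , v≡ = (c , down) , refl , admissible , v≡ , tt
  step-down {x} (hot , exit) | parL a b c | x∈ with down-from ev (here refl) tt (⅋-hot ev x∈ hot)
  ...   | admissible , v≡ = (c , down) , refl , admissible , v≡ , λ ()
  step-down {x} (hot , exit) | cutL a b | here refl with x ≟ x | cross-to (inj₁ ev) hot exit
  ... | yes _   | admissible , v≡ = (b , up) , refl , admissible , v≡ , tt
  ... | no x≢x  | _              = ⊥-elim (x≢x refl)
  step-down {x} (hot , exit) | cutL a b | there (here refl) with x ≟ a | cross-to (inj₂ ev) hot exit
  ... | no _       | admissible , v≡ = (a , up) , refl , admissible , v≡ , tt
  ... | yes refl   | _              = ⊥-elim (cut-premisses-distinct (inj₁ ev) refl)

  step-up : ∀ {y} → Admissible (y , up) → Leaves (above y) (ls (above y)) y conclR (exitLink (ls (above y)))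
  step-up {y} (entry , _) with ls (above y) in ev
  ... | axL _ _     = ⊥-elim entry
  ... | cutL _ _    = ⊥-elim entry
  ... | tensL _ _ _ = ⊥-elim entry
  ... | parL _ _ _  = ⊥-elim entry
  ... | oneL _      = ⊥-elim entry
  ... | syncL _     = sync-leaves ev
  ... | boxL l _ _ with typedAt ev
  ...   | boxT l-bot _ with down-from ev (here refl) refl (λ l-cold → case subst BotFree l-bot l-cold of λ ())
  ...     | admissible , v≡ = (l , down) , refl , admissible , v≡ , tt

  walk-step : ∀ {s} → Admissible s → Leaves (to (toStep s)) (ls (to (toStep s))) (edge (toStep s))
                                             (arrRole (dir (toStep s))) (successor s)
  walk-step {_ , down} = step-down
  walk-step {_ , up}   = step-up

  successor-next : ∀ {s} → Admissible s → successor s ≡ just (next s)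
  successor-next adm with walk-step adm
  ... | _ , succ≡ , _ rewrite succ≡ = refl

  walk-continues : ∀ {s} → Admissible s → Admissible (next s) × Consecutive ty ls (toStep s) (toStep (next s))
  walk-continues adm with walk-step adm
  ... | _ , succ≡ , adm′ , v≡ , switch rewrite succ≡ = adm′ , v≡ , switch

  cut-on : ∀ {c a b x y} → ls c ≡ cutL a b → x ∈ a ∷ b ∷ [] → y ∈ a ∷ b ∷ [] → x ≢ y → CutOn (ls c) x y
  cut-on ec (here refl)         (here refl)         x≢y = ⊥-elim (x≢y refl)
  cut-on ec (here refl)         (there (here refl)) _   = inj₁ ec
  cut-on ec (there (here refl)) (here refl)         _   = inj₂ ec
  cut-on ec (there (here refl)) (there (here refl)) x≢y = ⊥-elim (x≢y refl)

  crossLink-exit : ∀ x (l : Link e) {y} → UpInto l y → crossLink x l ≡ exitLink l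
  crossLink-exit x (axL _ _)     ()
  crossLink-exit x (cutL _ _)    ()
  crossLink-exit x (tensL _ _ _) ()
  crossLink-exit x (parL _ _ _)  ()
  crossLink-exit x (oneL _)      ()
  crossLink-exit x (syncL _)     _ = refl
  crossLink-exit x (boxL _ _ _)  _ = refl

  successor-by-target : ∀ {s t} → Admissible s → Admissible t → to (toStep s) ≡ to (toStep t) →
                        successor s ≡ successor t
  successor-by-target {y₁ , up} {y₂ , up} _ _ same = cong (exitLink ∘ ls) same
  successor-by-target {x , down} {y , up} _ (entry , _) same =
    trans (cong (crossLink x ∘ ls) same) (crossLink-exit x _ entry)
  successor-by-target {y , up} {x , down} (entry , _) _ same =
    sym (trans (cong (crossLink x ∘ ls) (sym same)) (crossLink-exit x _ entry))
  successor-by-target {x₁ , down} {x₂ , down} (hot₁ , exit₁) (hot₂ , exit₂) same with x₁ ≟ x₂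
  ... | yes refl = refl
  ... | no x₁≢x₂ rewrite same with ls (below x₂) in ev | subst (λ v → x₁ ∈ prems (ls v)) same (hot⇒below-prem hot₁) | hot⇒below-prem hot₂
  ...   | cutL _ _    | x₁∈ | x₂∈ = ⊥-elim (DownFrom∧UpInto⇒⊥ (ls (above x₂)) hot₂ exit₂ entry)
    where entry = proj₁ (proj₁ (cross-to (cut-on ev x₁∈ x₂∈ x₁≢x₂) hot₁ exit₁))
  ...   | axL _ _     | _ | _ = refl
  ...   | tensL _ _ _ | _ | _ = refl
  ...   | parL _ _ _  | _ | _ = refl
  ...   | oneL _      | _ | _ = refl
  ...   | syncL _     | _ | _ = refl
  ...   | boxL _ _ _  | _ | _ = refl

  isSwitchingWalk : IsSwitchingWalk ty ls toStep next Admissible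
  isSwitchingWalk = record
    { next-Inv       = proj₁ ∘ walk-continues
    ; step-valid     = step-valid
    ; step-next      = proj₂ ∘ walk-continues
    ; next-by-target = λ adm-s adm-t same → just-injective
        (trans (sym (successor-next adm-s)) (trans (successor-by-target adm-s adm-t same) (successor-next adm-t)))
    ; edge-injective = edge-injective }
    where
    step-valid : ∀ {s} → Admissible s → ValidStep ls (toStep s)
    step-valid {x , down} (hot , _)    = above-concl x , hot⇒below-prem hot
    step-valid {y , up}   (_ , _ , y∈) = below-prem y∈ , above-concl y

    edge-injective : ∀ {s t} → Admissible s → Admissible t → edge (toStep s) ≡ edge (toStep t) → s ≡ t
    edge-injective {x , down} {_ , down} _ _ refl = refl
    edge-injective {x , up}   {_ , up}   _ _ refl = refl
    edge-injective {x , down} {_ , up}   (hot , exit) (entry , _) refl = ⊥-elim (DownFrom∧UpInto⇒⊥ (ls (above x)) hot exit entry)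
    edge-injective {x , up}   {_ , down} (entry , _) (hot , exit) refl = ⊥-elim (DownFrom∧UpInto⇒⊥ (ls (above x)) hot exit entry)

  State-code : State → Fin (e * 2)
  State-code (x , d) = combine x (Dir-code d)

  State-code-injective : ∀ {s t} → State-code s ≡ State-code t → s ≡ t
  State-code-injective {x , d} {x′ , d′} eq with combine-injective x (Dir-code d) x′ (Dir-code d′) eq
  ... | refl , codes≡ with Dir-code-injective codes≡
  ...   | refl = refl

  admissible⇒SwitchingCycle : ∀ {s} → Admissible s → SwitchingCycle ty ls
  admissible⇒SwitchingCycle = switchingWalk⇒SwitchingCycle ty ls toStep next Admissible isSwitchingWalk State-code State-code-injective

  module _ (acyclic : ¬ SwitchingCycle ty ls) where

    no-box : ∀ {v l Γ M} → ls v ≡ boxL l Γ M → ⊥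
    no-box {l = l} ev with typedAt ev
    ... | boxT l-bot _ = acyclic (admissible⇒SwitchingCycle {l , down} (proj₁ (down-from ev (here refl) refl l-hot)))
      where
      l-hot : ¬ BotFree (ty l)
      l-hot l-cold = case subst BotFree l-bot l-cold of λ ()

    axiom-cut-cycle : ∀ {c u a b p r} → ls c ≡ cutL a b → ls u ≡ axL p r →
                      a ∈ concls (axL p r) → b ∈ concls (axL p r) → a ≢ b → SwitchingCycle ty ls
    axiom-cut-cycle {c} {u} {a} {b} {p} {r} ec eu a∈ b∈ a≢b = record
      { len = 1 ; st = st ; valid = valid ; chain = chain ; edgesDistinct = edges ; nodesDistinct = nodes }
      where
      st : Fin 2 → Step e m
      st fzero        = step a down u c
      st (fsuc fzero) = step b up c u

      concl : ∀ {x} → x ∈ concls (axL p r) → x ∈ concls (ls u)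
      concl = subst (λ l → _ ∈ concls l) (sym eu)

      prem : ∀ {x} → x ∈ prems (cutL a b) → x ∈ prems (ls c)
      prem = subst (λ l → _ ∈ prems l) (sym ec)

      valid : ∀ i → ValidStep ls (st i)
      valid fzero        = concl a∈ , prem (here refl)
      valid (fsuc fzero) = prem (there (here refl)) , concl b∈

      switch : ∀ {v l′ x r y s} → ls v ≡ l′ → Switch ty l′ x r y s → Switch ty (ls v) x r y s
      switch ev = subst (λ l → Switch ty l _ _ _ _) (sym ev)

      chain : ∀ i j → CycSucc i j → Consecutive ty ls (st i) (st j)
      chain fzero        (fsuc fzero) _ = refl , switch ec tt
      chain (fsuc fzero) fzero        _ = refl , switch eu tt
      chain fzero        fzero        (inj₁ ())
      chain fzero        fzero        (inj₂ (() , _))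
      chain (fsuc fzero) (fsuc fzero) (inj₁ ())
      chain (fsuc fzero) (fsuc fzero) (inj₂ (_ , ()))

      edges : ∀ {i j} → edge (st i) ≡ edge (st j) → i ≡ j
      edges {fzero}      {fzero}      _ = refl
      edges {fsuc fzero} {fsuc fzero} _ = refl
      edges {fzero}      {fsuc fzero} a≡b = ⊥-elim (a≢b a≡b)
      edges {fsuc fzero} {fzero}      b≡a = ⊥-elim (a≢b (sym b≡a))

      u≢c : u ≢ c
      u≢c refl = case trans (sym eu) ec of λ ()

      nodes : ∀ {i j} → from (st i) ≡ from (st j) → i ≡ j
      nodes {fzero}      {fzero}      _ = refl
      nodes {fsuc fzero} {fsuc fzero} _ = refl
      nodes {fzero}      {fsuc fzero} u≡c = ⊥-elim (u≢c u≡c)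
      nodes {fsuc fzero} {fzero}      c≡u = ⊥-elim (u≢c (sym c≡u))

    cut-premiss-descends : ∀ {c x y} → CutOn (ls c) x y → DownFrom (ls (above x)) x
    cut-premiss-descends {c} {x} {y} cut with ls (above x) in ex
    ... | boxL _ _ _  = ⊥-elim (no-box ex)
    ... | cutL _ _    = case above-concl-at ex of λ ()
    ... | tensL _ _ _ = tt
    ... | parL _ _ _  = tt
    ... | oneL _      = tt
    ... | syncL _     = tt
    ... | axL _ _ with above-concl-at ex | axiom-cut cut ex (above-concl-at ex)
    ...   | x∈ | y∈ = acyclic ([ (λ ec → axiom-cut-cycle ec ex x∈ y∈ x≢y)
                              , (λ ec → axiom-cut-cycle ec ex y∈ x∈ (x≢y ∘ sym)) ]′ cut)
      where x≢y = cut-premisses-distinct cut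

    no-cut : ∀ {c a b} → ls c ≡ cutL a b → ⊥
    no-cut {a = a} {b} ec with botFree? (ty a) | botFree? (ty b)
    ... | no a-hot | _        = acyclic (admissible⇒SwitchingCycle {a , down} (a-hot , cut-premiss-descends (inj₁ ec)))
    ... | yes _    | no b-hot = acyclic (admissible⇒SwitchingCycle {b , down} (b-hot , cut-premiss-descends (inj₂ ec)))
    ... | yes a-cold | yes b-cold =
      principal-cut (inj₁ ec) refl (cut-premiss-principal (inj₁ ec) (cut-premiss-descends (inj₁ ec)) (inj₂ b-cold))
                              refl (cut-premiss-principal (inj₂ ec) (cut-premiss-descends (inj₂ ec)) (inj₂ a-cold))

mainTheorem7 : (R : Net) → IsNet R → Closed R → NormalForm R → CutFree R
mainTheorem7 (net e m ty ls cs) (wf , acyclic , _) closed normal = cut-free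
  where
  open ClosedNormalNet ty ls cs wf closed normal

  cut-free : ∀ v → LinkCutFree (ls v)
  cut-free v with ls v in ev
  ... | cutL _ _    = no-cut acyclic ev
  ... | boxL _ _ _  = ⊥-elim (no-box acyclic ev)
  ... | axL _ _     = tt
  ... | tensL _ _ _ = tt
  ... | parL _ _ _  = tt
  ... | oneL _      = tt
  ... | syncL _     = tt
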